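{- Let $a,h,x,d$ be positive integers with $x<a$ and $\gcd(a,d)=1$. Then $$\min\{k\in\mathbb{N}\setminus\{0\} : ka\in\langle ha+d,ha+2d,\ldots,ha+xd\rangle\}=\left\lceil\frac{a}{x}\right\rceil h+d.$$
   Context: $\mathbb{N}=\{0,1,2,\ldots\}$. $\langle m_1,\ldots,m_r\rangle=\{\sum_j z_jm_j : z_j\in\mathbb{N}\}$ is the submonoid of $\mathbb{N}$ generated by $m_1,\ldots,m_r$. $\lceil r\rceil$ is the least integer $\geq r$. -}

module Defs where

open import Data.Nat using (ℕ; zero; suc; _+_; _*_; _∸_; _≤_; _<_; NonZero)
open import Data.Nat.DivMod using (_/_)
open import Data.Fin using (Fin; toℕ)
open import Data.Vec.Functional using (Vector; foldr)
open import Data.Product using (Σ; _×_)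
open import Relation.Binary.PropositionalEquality using (_≡_)

sumV : ∀ {r} → (Fin r → ℕ) → ℕ
sumV = foldr _+_ 0

InMonoid : ∀ {r} → (Fin r → ℕ) → ℕ → Set
InMonoid {r} m n = Σ (Fin r → ℕ) (λ z → sumV (λ j → z j * m j) ≡ n)

-- generators h a + d, h a + 2 d, …, h a + x d  (index j : Fin x stands for j+1)
gens : (a h x d : ℕ) → Fin x → ℕ
gens a h x d j = h * a + suc (toℕ j) * d

IsMin : (ℕ → Set) → ℕ → Set
IsMin P m = P m × (∀ k → P k → m ≤ k)

ceilDiv : (a x : ℕ) → .{{NonZero x}} → ℕ
ceilDiv a x = (a + x ∸ 1) / x

-- A combination ∑ z_j (h a + (j + 1) d) equals N h a + S d, where N = ∑ z_j
-- counts its summands and S = ∑ z_j (j + 1) is its weight, so N ≤ S ≤ N x.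
-- If it equals k a, coprimality of a and d forces a ∣ S; as k > 0, S = m a
-- with m ≥ 1, hence k = N h + m d with N ≥ S / x ≥ a / x, i.e.
-- k ≥ ⌈a/x⌉ h + d. Equality is attained by splitting a into ⌈a/x⌉ parts
-- from {1, …, x}, which is possible since ⌈a/x⌉ ≤ a ≤ ⌈a/x⌉ x.
{-# OPTIONS --safe #-}
module Submission where

open import Defs
open import Data.Nat using (ℕ; zero; suc; _+_; _*_; _∸_; _≤_; _<_; z≤n; s≤s; _≤?_; NonZero; >-nonZero)
open import Data.Nat.GCD using (gcd)
open import Data.Nat.Coprimality using (Coprime; gcd≡1⇒coprime; coprime-divisor)
open import Data.Nat.Divisibility using (_∣_; divides; ∣m+n∣m⇒∣n; n∣m*n; ∣n⇒∣m*n)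
open import Data.Nat.DivMod using (_%_; m≡m%n+[m/n]*n; m%n<n; m<n*o⇒m/o<n)
open import Data.Nat.Properties
open import Data.Nat.Solver using (module +-*-Solver)
open import Data.Fin using (Fin; toℕ; fromℕ; fromℕ<)
open import Data.Fin.Properties using (toℕ<n; toℕ-fromℕ; toℕ-fromℕ<)
open import Data.Product using (Σ; _×_; _,_)
open import Data.Vec.Functional using (Vector)
open import Function using (_∘_)
open import Relation.Nullary using (yes; no)
open import Relation.Binary.PropositionalEquality using (_≡_; refl; sym; trans; cong; cong₂; subst; module ≡-Reasoning)
open import Algebra.Properties.Semiring.Sum +-*-semiring using (sum; sum-cong-≗; sum-replicate-zero; ∑-distrib-+; *-distribʳ-sum)

open +-*-Solver using (solve; _:=_; _:+_; _:*_; con)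

sum-mono-≤ : ∀ {n} {f g : Vector ℕ n} → (∀ j → f j ≤ g j) → sum f ≤ sum g
sum-mono-≤ {zero}  f≤g = z≤n
sum-mono-≤ {suc n} f≤g = +-mono-≤ (f≤g Fin.zero) (sum-mono-≤ (f≤g ∘ Fin.suc))

δ : ∀ {n} → Fin n → Vector ℕ n
δ Fin.zero    Fin.zero    = 1
δ Fin.zero    (Fin.suc _) = 0
δ (Fin.suc _) Fin.zero    = 0
δ (Fin.suc i) (Fin.suc j) = δ i j

sum-δ : ∀ {n} (i : Fin n) → sum (δ i) ≡ 1
sum-δ {suc n} Fin.zero    = cong suc (sum-replicate-zero n)
sum-δ {suc n} (Fin.suc i) = sum-δ i

sum-δ-* : ∀ {n} (i : Fin n) (f : Vector ℕ n) → sum (λ j → δ i j * f j) ≡ f i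
sum-δ-* {suc n} Fin.zero    f = trans (cong₂ _+_ (*-identityˡ (f Fin.zero)) (sum-replicate-zero n)) (+-identityʳ (f Fin.zero))
sum-δ-* {suc n} (Fin.suc i) f = sum-δ-* i (f ∘ Fin.suc)

weight : ∀ {x} → Vector ℕ x → ℕ
weight z = sum (λ j → z j * suc (toℕ j))

sum≤weight : ∀ {x} (z : Vector ℕ x) → sum z ≤ weight z
sum≤weight z = sum-mono-≤ (λ j → m≤m*n (z j) (suc (toℕ j)))

weight≤sum*x : ∀ {x} (z : Vector ℕ x) → weight z ≤ sum z * x
weight≤sum*x {x} z = begin
  weight z                ≤⟨ sum-mono-≤ (λ j → *-monoʳ-≤ (z j) (toℕ<n j)) ⟩
  sum (λ j → z j * x)     ≡⟨ *-distribʳ-sum x z ⟨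
  sum z * x               ∎
  where open ≤-Reasoning

sum-gens : ∀ {x} a h d (z : Vector ℕ x) →
           sum (λ j → z j * gens a h x d j) ≡ sum z * (h * a) + weight z * d
sum-gens a h d z = begin
  sum (λ j → z j * (h * a + suc (toℕ j) * d))
    ≡⟨ sum-cong-≗ (λ j → trans (*-distribˡ-+ (z j) (h * a) _) (cong (z j * (h * a) +_) (sym (*-assoc (z j) _ d)))) ⟩
  sum (λ j → z j * (h * a) + z j * suc (toℕ j) * d)
    ≡⟨ ∑-distrib-+ (λ j → z j * (h * a)) (λ j → z j * suc (toℕ j) * d) ⟩
  sum (λ j → z j * (h * a)) + sum (λ j → z j * suc (toℕ j) * d)
    ≡⟨ cong₂ _+_ (*-distribʳ-sum (h * a) z) (*-distribʳ-sum d (λ j → z j * suc (toℕ j))) ⟨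
  sum z * (h * a) + weight z * d ∎
  where open ≡-Reasoning

-- z j is the number of parts equal to j + 1.
Partition : (x c n : ℕ) → Set
Partition x c n = Σ (Vector ℕ x) (λ z → sum z ≡ c × weight z ≡ n)

add-part : ∀ {x c n} (i : Fin x) → Partition x c n → Partition x (suc c) (n + suc (toℕ i))
add-part {c = c} {n} i (z , sum≡c , weight≡n) = (λ j → z j + δ i j) , sum≡1+c , weight≡n+i
  where
  open ≡-Reasoning
  sum≡1+c : sum (λ j → z j + δ i j) ≡ suc c
  sum≡1+c = begin
    sum (λ j → z j + δ i j) ≡⟨ ∑-distrib-+ z (δ i) ⟩
    sum z + sum (δ i)       ≡⟨ cong₂ _+_ sum≡c (sum-δ i) ⟩
    c + 1                   ≡⟨ +-comm c 1 ⟩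
    suc c                   ∎
  weight≡n+i : weight (λ j → z j + δ i j) ≡ n + suc (toℕ i)
  weight≡n+i = begin
    sum (λ j → (z j + δ i j) * suc (toℕ j))
      ≡⟨ sum-cong-≗ (λ j → *-distribʳ-+ (suc (toℕ j)) (z j) (δ i j)) ⟩
    sum (λ j → z j * suc (toℕ j) + δ i j * suc (toℕ j))
      ≡⟨ ∑-distrib-+ (λ j → z j * suc (toℕ j)) (λ j → δ i j * suc (toℕ j)) ⟩
    weight z + sum (λ j → δ i j * suc (toℕ j))
      ≡⟨ cong₂ _+_ weight≡n (sum-δ-* i (λ j → suc (toℕ j))) ⟩
    n + suc (toℕ i) ∎

-- The new part is e + 1 when that fits, and otherwise the largest part x' + 1.
partition-of-c+ : ∀ x' c e → e ≤ c * x' → Partition (suc x') c (c + e)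
partition-of-c+ x' zero    zero z≤n = (λ _ → 0) , sum-replicate-zero (suc x') , sum-replicate-zero (suc x')
partition-of-c+ x' (suc c) e e≤ with e ≤? x'
... | yes e≤x' = subst (Partition (suc x') (suc c)) total
      (add-part (fromℕ< (s≤s e≤x')) (partition-of-c+ x' c 0 z≤n))
  where
  total : c + 0 + suc (toℕ (fromℕ< (s≤s e≤x'))) ≡ suc c + e
  total rewrite toℕ-fromℕ< (s≤s e≤x') | +-identityʳ c = +-suc c e
... | no e≰x' with m≤n⇒∃[o]m+o≡n (<⇒≤ (≰⇒> e≰x'))
...   | f , refl = subst (Partition (suc x') (suc c)) total
      (add-part (fromℕ x') (partition-of-c+ x' c f (+-cancelˡ-≤ x' f (c * x') e≤)))
  where
  total : c + f + suc (toℕ (fromℕ x')) ≡ suc c + (x' + f)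
  total rewrite toℕ-fromℕ x' =
    solve 3 (λ c f x' → c :+ f :+ (con 1 :+ x') := con 1 :+ c :+ (x' :+ f)) refl c f x'

partition-exists : ∀ x' {c n} → c ≤ n → n ≤ c * suc x' → Partition (suc x') c n
partition-exists x' {c} {n} c≤n n≤c*x =
  subst (Partition (suc x') c) (m+[n∸m]≡n c≤n)
    (partition-of-c+ x' c (n ∸ c) (m≤n+o⇒m∸n≤o n c (subst (n ≤_) (*-suc c x') n≤c*x)))

a≤ceilDiv[a,n]*n : ∀ a n .{{_ : NonZero n}} → a ≤ ceilDiv a n * n
a≤ceilDiv[a,n]*n a n@(suc n-1) = +-cancelʳ-≤ n-1 a (ceilDiv a n * n) (begin
  a + n-1                  ≡⟨ +-∸-assoc a (s≤s z≤n) ⟨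
  a + n ∸ 1                ≡⟨ m≡m%n+[m/n]*n (a + n ∸ 1) n ⟩
  r + ceilDiv a n * n      ≤⟨ +-monoˡ-≤ (ceilDiv a n * n) (≤-pred (m%n<n (a + n ∸ 1) n)) ⟩
  n-1 + ceilDiv a n * n    ≡⟨ +-comm n-1 _ ⟩
  ceilDiv a n * n + n-1    ∎)
  where
  open ≤-Reasoning
  r = (a + n ∸ 1) % n

a≤m*n⇒ceilDiv[a,n]≤m : ∀ a n .{{_ : NonZero n}} {m} → a ≤ m * n → ceilDiv a n ≤ m
a≤m*n⇒ceilDiv[a,n]≤m a n@(suc n-1) {m} a≤m*n = ≤-pred (m<n*o⇒m/o<n (begin-strict
  a + n ∸ 1   ≡⟨ +-∸-assoc a (s≤s z≤n) ⟩
  a + n-1     <⟨ +-monoʳ-< a (n<1+n n-1) ⟩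
  a + n       ≤⟨ +-monoˡ-≤ n a≤m*n ⟩
  m * n + n   ≡⟨ +-comm (m * n) n ⟩
  suc m * n   ∎))
  where open ≤-Reasoning

coprime-∣-weight : ∀ {a d} h N S k → Coprime a d → N * (h * a) + S * d ≡ k * a → a ∣ S
coprime-∣-weight {a} {d} h N S k a⊥d eq =
  coprime-divisor a⊥d (subst (a ∣_) (*-comm S d) a∣S*d)
  where
  a∣S*d : a ∣ S * d
  a∣S*d = ∣m+n∣m⇒∣n (subst (a ∣_) (sym eq) (n∣m*n k)) (∣n⇒∣m*n N (n∣m*n h))

ceilDiv*h+d-≤ : ∀ {a d h x N S k} .{{_ : NonZero x}} → Coprime a d → 0 < a → 0 < k →
                N ≤ S → S ≤ N * x → N * (h * a) + S * d ≡ k * a → ceilDiv a x * h + d ≤ k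
ceilDiv*h+d-≤ {h = h} {N = N} {S} {k} a⊥d _ _ _ _ eq with coprime-∣-weight h N S k a⊥d eq
ceilDiv*h+d-≤ _ (s≤s _) (s≤s _) z≤n _ () | divides zero refl
ceilDiv*h+d-≤ {a} {d} {h} {x} {N} {k = k} _ 0<a _ _ S≤N*x eq | divides (suc m) refl =
  subst (ceilDiv a x * h + d ≤_) (sym k≡Nh+md)
    (+-mono-≤ (*-monoˡ-≤ h c≤N) (m≤m+n d (m * d)))
  where
  c≤N : ceilDiv a x ≤ N
  c≤N = a≤m*n⇒ceilDiv[a,n]≤m a x (≤-trans (m≤m+n a (m * a)) S≤N*x)
  k≡Nh+md : k ≡ N * h + suc m * d
  k≡Nh+md = *-cancelʳ-≡ k (N * h + suc m * d) a {{>-nonZero 0<a}} (trans (sym eq)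
    (solve 5 (λ N h a m d → N :* (h :* a) :+ (m :* a) :* d := (N :* h :+ m :* d) :* a) refl N h a (suc m) d))

partition⇒InMonoid : ∀ {x c} a h d → Partition x c a → InMonoid (gens a h x d) ((c * h + d) * a)
partition⇒InMonoid {c = c} a h d (z , sum≡c , weight≡a) = z , (begin
  sum (λ j → z j * gens a h _ d j) ≡⟨ sum-gens a h d z ⟩
  sum z * (h * a) + weight z * d   ≡⟨ cong₂ (λ N S → N * (h * a) + S * d) sum≡c weight≡a ⟩
  c * (h * a) + a * d              ≡⟨ solve 4 (λ c h a d → c :* (h :* a) :+ a :* d := (c :* h :+ d) :* a) refl c h a d ⟩
  (c * h + d) * a                  ∎)
  where open ≡-Reasoning

mainTheorem3 : (a h x d : ℕ) → 0 < a → 0 < h → (0<x : 0 < x) → 0 < d →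
    x < a → gcd a d ≡ 1 →
    IsMin (λ k → 0 < k × InMonoid (gens a h x d) (k * a))
          (ceilDiv a x {{>-nonZero 0<x}} * h + d)
mainTheorem3 a h x@(suc x') d 0<a _ _ 0<d _ gcd≡1 = (0<c*h+d , partition⇒InMonoid a h d partition) , minimal
  where
  c = ceilDiv a x
  partition : Partition x c a
  partition = partition-exists x' (a≤m*n⇒ceilDiv[a,n]≤m a x (m≤m*n a x)) (a≤ceilDiv[a,n]*n a x)
  0<c*h+d : 0 < c * h + d
  0<c*h+d = ≤-trans 0<d (m≤n+m d (c * h))
  minimal : ∀ k → 0 < k × InMonoid (gens a h x d) (k * a) → c * h + d ≤ k
  minimal k (0<k , w , eq) = ceilDiv*h+d-≤ (gcd≡1⇒coprime gcd≡1) 0<a 0<k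
    (sum≤weight w) (weight≤sum*x w) (trans (sym (sum-gens a h d w)) eq)
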